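{- For $i=1,2,3$, $$\big\|\bar g_{l_{i,1}}\ast_{l_{i,3}}^{l_{i,2}}\bar g_{l_{i,4}}\big\|_2^2=\sum_{I\subseteq\{11,12,21,22\}}(-1)^{|I|}\pi(H_{i,I}),$$ where $(l_{1,1},l_{1,2},l_{1,3},l_{1,4})=(1,0,1,1)$, $(l_{2,1},l_{2,2},l_{2,3},l_{2,4})=(2,1,1,2)$ and $(l_{3,1},l_{3,2},l_{3,3},l_{3,4})=(2,1,1,1)$; i.e. the left-hand sides are $\|\bar g_1\ast_1^0\bar g_1\|_2^2$, $\|\bar g_2\ast_1^1\bar g_2\|_2^2$, $\|\bar g_2\ast_1^1\bar g_1\|_2^2$.
   Context: Random intersection graph $\mathcal G(n,m,p)$ with $n\ge8$: vertex set $\{v_1,\dots,v_n\}$, $m$ attributes, each vertex chooses each attribute independently with probability $p\in(0,1)$, vertices adjacent iff they share an attribute; $\hat p=1-(1-p^2)^m$. For a graph $H$ with $V(H)\subseteq\{v_1,\dots,v_n\}$, $\pi(H)=\mathbb P(H\subseteq\mathcal G(n,m,p))$. $\mu_{m,p}(x)=p^{|x|}(1-p)^{m-|x|}$ on $\{0,1\}^m$. $g(x,y)=1$ iff $x_k=y_k=1$ for some $k$, else $0$; $g_1(x)=\int g(x,y)\,d\mu_{m,p}(y)$; $\bar g_2=g-\hat p$, $\bar g_1=g_1-\hat p$. Contraction: $f\ast_b^ah(x_1,\dots,x_{b-a},y_1,\dots,y_{k-b},z_1,\dots,z_{l-b})=\int_{(\{0,1\}^m)^a}f(w,x,y)\,h(w,x,z)\,d\mu_{m,p}^{\otimes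 a}(w)$ for $f$ on $k$ and $h$ on $l$ coordinates; norms are $L^2$ w.r.t. products of $\mu_{m,p}$. Graphs (vertices in $\{v_1,\dots,v_n\}$, edges labelled by $\{11,12,21,22\}$): $G_1$ is a star with centre $v$ and leaves $u_{11},u_{12},u_{21},u_{22}$, $e_{ab}=\{v,u_{ab}\}$; $G_2$ is a $4$-cycle on $x_1,x_2,y_1,y_2$ with $e_{ab}=\{x_a,y_b\}$; $G_3$ is a path $z_{12}\,x_1\,y\,x_2\,z_{22}$ with $e_{11}=\{x_1,y\}$, $e_{12}=\{x_1,z_{12}\}$, $e_{21}=\{x_2,y\}$, $e_{22}=\{x_2,z_{22}\}$. For $I\subseteq\{11,12,21,22\}$, $G_{i,I}$ is the subgraph of $G_i$ formed by the edges $e_{ab}$, $ab\in I$, and their endpoints ($G_{i,\emptyset}$ empty). $H_{i,I}$ is a graph on $8$ vertices of $\{v_1,\dots,v_n\}$ consisting of a copy of $G_{i,I}$, vertex-disjoint isolated edges $e_{ab}$ for $ab\notin I$, and isolated vertices as needed. (Equivalently $\pi(H_{i,I})=\hat p^{4-|I|}\pi(G_{i,I})$ with $\pi(G_{i,\emptyset})=1$.)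
   Formalization: The attribute probability p of $\mathcal G(n,m,p)$ ranges over the rationals in (0,1). -}

module Defs where

open import Data.Bool using (Bool; true; false; if_then_else_; _∧_; _∨_; not)
open import Data.Nat using (ℕ; zero; suc; _≤_)
open import Data.Fin using (Fin; zero; suc; inject≤; #_)
open import Data.Fin.Subset using (Subset; ∣_∣)
open import Data.Vec using (Vec; []; _∷_; lookup)
open import Data.List using (List; []; _∷_; map; concatMap; foldr; filterᵇ)
open import Data.Bool.ListAction using (any)
open import Data.Product using (_×_; _,_; proj₁; proj₂)
open import Data.Rational using (ℚ; 0ℚ; 1ℚ; _+_; _*_; _-_; -_)
open import Relation.Nullary.Decidable using (⌊_⌋)
import Data.Fin as F

infixr 8 _^q_
_^q_ : ℚ → ℕ → ℚ
x ^q zero = 1ℚ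
x ^q suc k = x * (x ^q k)

sumL : List ℚ → ℚ
sumL = foldr _+_ 0ℚ

prodL : List ℚ → ℚ
prodL = foldr _*_ 1ℚ

-- attribute sets: elements of {0,1}^m
Att : ℕ → Set
Att m = Vec Bool m

allVecs : (m : ℕ) → List (Vec Bool m)
allVecs zero = [] ∷ []
allVecs (suc m) = concatMap (λ xs → (true ∷ xs) ∷ (false ∷ xs) ∷ []) (allVecs m)

-- μ_{m,p}(x) = p^{|x|} (1-p)^{m-|x|}, written as a product over coordinates
μ : {m : ℕ} → ℚ → Att m → ℚ
μ p [] = 1ℚ
μ p (b ∷ x) = (if b then p else (1ℚ - p)) * μ p x

E : (m : ℕ) → ℚ → (Att m → ℚ) → ℚ
E m p f = sumL (map (λ x → μ p x * f x) (allVecs m))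

Ek : (m : ℕ) → ℚ → (k : ℕ) → (Vec (Att m) k → ℚ) → ℚ
Ek m p zero f = f []
Ek m p (suc k) f = E m p (λ x → Ek m p k (λ xs → f (x ∷ xs)))

share : {m : ℕ} → Att m → Att m → Bool
share [] [] = false
share (a ∷ x) (b ∷ y) = (a ∧ b) ∨ share x y

g : {m : ℕ} → Att m → Att m → ℚ
g x y = if share x y then 1ℚ else 0ℚ

phat : ℕ → ℚ → ℚ
phat m p = 1ℚ - (1ℚ - p * p) ^q m

g₁ : (m : ℕ) → ℚ → Att m → ℚ
g₁ m p x = E m p (λ y → g x y)

gbar₂ : (m : ℕ) → ℚ → Vec (Att m) 2 → ℚ
gbar₂ m p (x ∷ y ∷ []) = g x y - phat m p

gbar₁ : (m : ℕ) → ℚ → Vec (Att m) 1 → ℚ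
gbar₁ m p (x ∷ []) = g₁ m p x - phat m p

-- Contraction f ∗_b^a h, with c = b - a, r = k - b, s = l - b:
-- f has a + c + r coordinates, h has a + c + s coordinates; the result
-- is a function of (x , y , z) ∈ (Att m)^c × (Att m)^r × (Att m)^s.
contr : (m : ℕ) → ℚ → (a c r s : ℕ) →
        (Vec (Att m) (Data.Nat._+_ a (Data.Nat._+_ c r)) → ℚ) →
        (Vec (Att m) (Data.Nat._+_ a (Data.Nat._+_ c s)) → ℚ) →
        Vec (Att m) c → Vec (Att m) r → Vec (Att m) s → ℚ
contr m p a c r s f h x y z =
  Ek m p a (λ w → f (w Data.Vec.++ (x Data.Vec.++ y)) * h (w Data.Vec.++ (x Data.Vec.++ z)))

normSq : (m : ℕ) → ℚ → (c r s : ℕ) →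
         (Vec (Att m) c → Vec (Att m) r → Vec (Att m) s → ℚ) → ℚ
normSq m p c r s F =
  Ek m p c (λ x → Ek m p r (λ y → Ek m p s (λ z → F x y z * F x y z)))

-- Left-hand sides, i ∈ {1,2,3} encoded as Fin 3 = {0,1,2}:
--  i=1: ‖ḡ₁ ∗₁⁰ ḡ₁‖²  (a=0,b=1,k=l=1)
--  i=2: ‖ḡ₂ ∗₁¹ ḡ₂‖²  (a=1,b=1,k=l=2)
--  i=3: ‖ḡ₂ ∗₁¹ ḡ₁‖²  (a=1,b=1,k=2,l=1)
LHS : (m : ℕ) → ℚ → Fin 3 → ℚ
LHS m p zero = normSq m p 1 0 0 (contr m p 0 1 0 0 (gbar₁ m p) (gbar₁ m p))
LHS m p (suc zero) = normSq m p 0 1 1 (contr m p 1 0 1 1 (gbar₂ m p) (gbar₂ m p))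
LHS m p (suc (suc zero)) = normSq m p 0 1 0 (contr m p 1 0 1 0 (gbar₂ m p) (gbar₁ m p))

Graph : ℕ → Set
Graph n = List (Fin n × Fin n)

-- π(H) = P(H ⊆ G(n,m,p)): each vertex v gets attribute set x_v ~ μ_{m,p}
-- independently; all edges of H must be present.
π : (n m : ℕ) → ℚ → Graph n → ℚ
π n m p H = Ek m p n (λ xs → prodL (map (λ e → g (lookup xs (proj₁ e))
                                                 (lookup xs (proj₂ e))) H))

-- Edge labels 11,12,21,22 encoded as Fin 4 = # 0, # 1, # 2, # 3.
-- Vertex labels (in Fin 8) of G_1: v=0,u11=1,u12=2,u21=3,u22=4
-- Vertex labels of G_2: x1=0,x2=1,y1=2,y2=3
-- Vertex labels of G_3: x1=0,x2=1,y=2,z12=3,z22=4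
edgeG : Fin 3 → Fin 4 → Fin 8 × Fin 8
edgeG zero ab = (# 0 , suc (inject≤ ab (Data.Nat.s≤s (Data.Nat.s≤s (Data.Nat.s≤s (Data.Nat.s≤s Data.Nat.z≤n))))))
edgeG (suc zero) zero = (# 0 , # 2)
edgeG (suc zero) (suc zero) = (# 0 , # 3)
edgeG (suc zero) (suc (suc zero)) = (# 1 , # 2)
edgeG (suc zero) (suc (suc (suc zero))) = (# 1 , # 3)
edgeG (suc (suc zero)) zero = (# 0 , # 2)
edgeG (suc (suc zero)) (suc zero) = (# 0 , # 3)
edgeG (suc (suc zero)) (suc (suc zero)) = (# 1 , # 2)
edgeG (suc (suc zero)) (suc (suc (suc zero))) = (# 1 , # 4)

labels : List (Fin 4)
labels = # 0 ∷ # 1 ∷ # 2 ∷ # 3 ∷ []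

allFin8 : List (Fin 8)
allFin8 = # 0 ∷ # 1 ∷ # 2 ∷ # 3 ∷ # 4 ∷ # 5 ∷ # 6 ∷ # 7 ∷ []

_∈I_ : Fin 4 → Subset 4 → Bool
ab ∈I I = lookup I ab

eqF : Fin 8 → Fin 8 → Bool
eqF u v = ⌊ u F.≟ v ⌋

-- G_{i,I}: the edges e_ab with ab ∈ I (its vertices are their endpoints)
edgesGI : Fin 3 → Subset 4 → List (Fin 8 × Fin 8)
edgesGI i I = map (edgeG i) (filterᵇ (λ ab → ab ∈I I) labels)

usedBy : List (Fin 8 × Fin 8) → Fin 8 → Bool
usedBy es v = any (λ e → eqF v (proj₁ e) ∨ eqF v (proj₂ e)) es

pairUp : List (Fin 4) → List (Fin 8) → List (Fin 8 × Fin 8)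
pairUp (_ ∷ ls) (u ∷ v ∷ vs) = (u , v) ∷ pairUp ls vs
pairUp _ _ = []

-- H_{i,I} on the 8 vertices {v_1,…,v_8} ≅ Fin 8: a copy of G_{i,I} plus
-- vertex-disjoint isolated edges (on vertices not used by G_{i,I}), one for
-- each ab ∉ I. (There are always enough free vertices: at least 2(4-|I|).)
H8 : Fin 3 → Subset 4 → Graph 8
H8 i I = edgesGI i I Data.List.++
         pairUp (filterᵇ (λ ab → not (ab ∈I I)) labels)
                (filterᵇ (λ v → not (usedBy (edgesGI i I) v)) allFin8)

-- embed a graph on Fin 8 into {v_1,…,v_n}, n ≥ 8 (v_1,…,v_8 are used)
embed : {n : ℕ} → 8 ≤ n → Graph 8 → Graph n
embed le = map (λ e → (inject≤ (proj₁ e) le , inject≤ (proj₂ e) le))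

H : {n : ℕ} → 8 ≤ n → Fin 3 → Subset 4 → Graph n
H le i I = embed le (H8 i I)

sgn : ℕ → ℚ
sgn k = (- 1ℚ) ^q k

allSubsets : List (Subset 4)
allSubsets = allVecs 4

RHS : (n m : ℕ) → ℚ → 8 ≤ n → Fin 3 → ℚ
RHS n m p le i = sumL (map (λ I → sgn ∣ I ∣ * π n m p (H le i I)) allSubsets)

{-# OPTIONS --safe #-}

-- Write ḡ x y = g x y - p̂. Unfolding the contractions, each left-hand side is the integral,
-- over independent attribute sets attached to the vertices of G_i, of the product of ḡ over
-- the four edges e_ab. Expanding the product, ∏ (g_ab - p̂) = ∑_I (-1)^(4-|I|) p̂^(4-|I|) ∏_{ab∈I} g_ab,
-- where (-1)^(4-|I|) = (-1)^|I|, and the integral of ∏_{ab∈I} g_ab is π(G_{i,I}). Finally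
-- p̂^(4-|I|) π(G_{i,I}) = π(H_{i,I}): an isolated edge is the only edge touching its two endpoints,
-- so integrating out these two attribute sets first contributes a factor E E g = p̂.

module Submission where

open import Defs
open import Data.Nat using (ℕ; _≤_)
open import Data.Fin using (Fin)
open import Data.Rational using (ℚ; 0ℚ; 1ℚ; _<_)
open import Relation.Binary.PropositionalEquality using (_≡_)

open import Data.Bool using (Bool; true; false; not)
open import Data.Fin using (zero; suc; #_; inject≤)
import Data.Fin as Fin
open import Data.Fin.Subset using (Subset; ∣_∣)
open import Data.Fin.Subset.Properties using (∣p∣≤n)
open import Data.List using (List; []; _∷_; map; concatMap; filterᵇ; allFin; length)
import Data.List as List
open import Data.List.Membership.Propositional using (_∈_)
open import Data.List.Membership.Propositional.Properties using (∈-concatMap⁺; ∈-allFin)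
open import Data.List.Properties using (map-∘)
open import Data.List.Relation.Unary.All as All using (All; []; _∷_)
open import Data.List.Relation.Unary.Any as Any using (here; there)
open import Data.Maybe using (Maybe; just; nothing)
open import Data.Nat using (zero; suc; z≤n; s≤s)
import Data.Nat as ℕ
import Data.Nat.Properties as ℕ
open import Data.Product using (_×_; _,_; proj₁; proj₂)
open import Data.Rational using (_+_; _*_; _-_; -_)
open import Data.Rational.Properties using (+-*-commutativeRing; *-distribˡ-+; *-zeroʳ; *-comm)
import Data.Rational.Properties as ℚ
open import Data.Unit using (⊤; tt)
open import Data.Vec using (Vec; []; _∷_; lookup; head; insertAt; _[_]≔_)
open import Data.Vec.Properties using (lookup∘update; lookup∘update′)
open import Function using (_∘_)
open import Relation.Binary.PropositionalEquality
  using (_≢_; refl; sym; trans; cong; cong₂; module ≡-Reasoning)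
open import Relation.Nullary using (Dec; yes; no; ¬?; _×-dec_)
open import Relation.Nullary.Decidable using (from-yes)
open import Tactic.RingSolver using (solve-∀)
import Tactic.RingSolver.Core.AlmostCommutativeRing as ACR

ℚ-ring : ACR.AlmostCommutativeRing _ _
ℚ-ring = ACR.fromCommutativeRing +-*-commutativeRing isZero
  where
  isZero : (x : ℚ) → Maybe (0ℚ ≡ x)
  isZero x with 0ℚ ℚ.≟ x
  ... | yes 0≡x = just 0≡x
  ... | no _    = nothing

module _ {A : Set} where

  sumL-cong : {f h : A → ℚ} → (∀ x → f x ≡ h x) → ∀ xs → sumL (map f xs) ≡ sumL (map h xs)
  sumL-cong f≡h []       = refl
  sumL-cong f≡h (x ∷ xs) = cong₂ _+_ (f≡h x) (sumL-cong f≡h xs)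

  sumL-zero : ∀ (xs : List A) → sumL (map (λ _ → 0ℚ) xs) ≡ 0ℚ
  sumL-zero []       = refl
  sumL-zero (x ∷ xs) = trans (ℚ.+-identityˡ _) (sumL-zero xs)

  sumL-+ : ∀ (f h : A → ℚ) xs → sumL (map (λ x → f x + h x) xs) ≡ sumL (map f xs) + sumL (map h xs)
  sumL-+ f h []       = refl
  sumL-+ f h (x ∷ xs) = trans (cong (f x + h x +_) (sumL-+ f h xs)) (interchange (f x) (h x) _ _)
    where
    interchange : ∀ a b c d → (a + b) + (c + d) ≡ (a + c) + (b + d)
    interchange = solve-∀ ℚ-ring

  sumL-*ˡ : ∀ c (f : A → ℚ) xs → sumL (map (λ x → c * f x) xs) ≡ c * sumL (map f xs)
  sumL-*ˡ c f []       = sym (*-zeroʳ c)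
  sumL-*ˡ c f (x ∷ xs) = trans (cong (c * f x +_) (sumL-*ˡ c f xs)) (sym (*-distribˡ-+ c (f x) _))

  sumL-neg : ∀ (f : A → ℚ) xs → sumL (map (λ x → - f x) xs) ≡ - sumL (map f xs)
  sumL-neg f []       = refl
  sumL-neg f (x ∷ xs) = trans (cong (- f x +_) (sumL-neg f xs)) (sym (ℚ.neg-distrib-+ (f x) _))

sumL-concatMap-pair : ∀ {A B : Set} (h : B → ℚ) (l r : A → B) xs →
  sumL (map h (concatMap (λ x → l x ∷ r x ∷ []) xs)) ≡ sumL (map (λ x → h (l x) + h (r x)) xs)
sumL-concatMap-pair h l r []       = refl
sumL-concatMap-pair h l r (x ∷ xs) =
  trans (cong (λ s → h (l x) + (h (r x) + s)) (sumL-concatMap-pair h l r xs))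
        (sym (ℚ.+-assoc (h (l x)) (h (r x)) _))

sumL-swap : ∀ {A B : Set} (F : A → B → ℚ) xs ys →
  sumL (map (λ x → sumL (map (F x) ys)) xs) ≡ sumL (map (λ y → sumL (map (λ x → F x y) xs)) ys)
sumL-swap F []       ys = sym (sumL-zero ys)
sumL-swap F (x ∷ xs) ys =
  trans (cong (sumL (map (F x) ys) +_) (sumL-swap F xs ys))
        (sym (sumL-+ (F x) (λ y → sumL (map (λ x → F x y) xs)) ys))

module _ (m : ℕ) (p : ℚ) where

  E-cong : {f h : Att m → ℚ} → (∀ x → f x ≡ h x) → E m p f ≡ E m p h
  E-cong f≡h = sumL-cong (λ x → cong (μ p x *_) (f≡h x)) (allVecs m)

  E-+ : (f h : Att m → ℚ) → E m p (λ x → f x + h x) ≡ E m p f + E m p h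
  E-+ f h = trans (sumL-cong (λ x → *-distribˡ-+ (μ p x) (f x) (h x)) (allVecs m))
                  (sumL-+ (λ x → μ p x * f x) (λ x → μ p x * h x) (allVecs m))

  E-*ˡ : ∀ c (f : Att m → ℚ) → E m p (λ x → c * f x) ≡ c * E m p f
  E-*ˡ c f = trans (sumL-cong (λ x → swap (μ p x) c (f x)) (allVecs m))
                   (sumL-*ˡ c (λ x → μ p x * f x) (allVecs m))
    where
    swap : ∀ a b c → a * (b * c) ≡ b * (a * c)
    swap = solve-∀ ℚ-ring

  E-*ʳ : ∀ c (f : Att m → ℚ) → E m p (λ x → f x * c) ≡ E m p f * c
  E-*ʳ c f = trans (E-cong (λ x → *-comm (f x) c)) (trans (E-*ˡ c f) (*-comm c _))

  E-neg : (f : Att m → ℚ) → E m p (λ x → - f x) ≡ - E m p f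
  E-neg f = trans (sumL-cong (λ x → sym (ℚ.neg-distribʳ-* (μ p x) (f x))) (allVecs m))
                  (sumL-neg (λ x → μ p x * f x) (allVecs m))

  E-swap : (F : Att m → Att m → ℚ) → E m p (λ x → E m p (λ y → F x y)) ≡ E m p (λ y → E m p (λ x → F x y))
  E-swap F = begin
    sumL (map (λ x → μ p x * sumL (map (λ y → μ p y * F x y) xs)) xs)
      ≡⟨ sumL-cong (λ x → sym (sumL-*ˡ (μ p x) (λ y → μ p y * F x y) xs)) xs ⟩
    sumL (map (λ x → sumL (map (λ y → μ p x * (μ p y * F x y)) xs)) xs)
      ≡⟨ sumL-swap (λ x y → μ p x * (μ p y * F x y)) xs xs ⟩
    sumL (map (λ y → sumL (map (λ x → μ p x * (μ p y * F x y)) xs)) xs)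
      ≡⟨ sumL-cong (λ y → trans (sumL-cong (λ x → swap (μ p x) (μ p y) (F x y)) xs)
                                (sumL-*ˡ (μ p y) (λ x → μ p x * F x y) xs)) xs ⟩
    sumL (map (λ y → μ p y * sumL (map (λ x → μ p x * F x y) xs)) xs) ∎
    where
    open ≡-Reasoning
    xs : List (Att m)
    xs = allVecs m
    swap : ∀ a b c → a * (b * c) ≡ b * (a * c)
    swap = solve-∀ ℚ-ring

E-suc : ∀ m p (f : Att (suc m) → ℚ) →
  E (suc m) p f ≡ E m p (λ x → p * f (true ∷ x) + (1ℚ - p) * f (false ∷ x))
E-suc m p f = trans (sumL-concatMap-pair (λ x → μ p x * f x) (true ∷_) (false ∷_) (allVecs m))
                    (sumL-cong (λ x → factor p (μ p x) (f (true ∷ x)) (f (false ∷ x))) (allVecs m))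
  where
  factor : ∀ p u a b → (p * u) * a + ((1ℚ - p) * u) * b ≡ u * (p * a + (1ℚ - p) * b)
  factor = solve-∀ ℚ-ring

E-const : ∀ m p c → E m p (λ _ → c) ≡ c
E-const zero    p c = trans (ℚ.+-identityʳ _) (ℚ.*-identityˡ c)
E-const (suc m) p c = trans (E-suc m p (λ _ → c)) (trans (E-cong m p (λ _ → convex p c)) (E-const m p c))
  where
  convex : ∀ p c → p * c + (1ℚ - p) * c ≡ c
  convex = solve-∀ ℚ-ring

module _ (m : ℕ) (p : ℚ) where

  E-sub : (f h : Att m → ℚ) → E m p (λ x → f x - h x) ≡ E m p f - E m p h
  E-sub f h = trans (E-+ m p f (λ x → - h x)) (cong (E m p f +_) (E-neg m p h))

  E-const-sub : ∀ c (f : Att m → ℚ) → E m p (λ x → c - f x) ≡ c - E m p f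
  E-const-sub c f = trans (E-sub (λ _ → c) f) (cong (_- E m p f) (E-const m p c))

  E-sub-const : ∀ (f : Att m → ℚ) c → E m p (λ x → f x - c) ≡ E m p f - c
  E-sub-const f c = trans (E-sub f (λ _ → c)) (cong (λ a → E m p f - a) (E-const m p c))

non-edge-probability : ∀ m p → E m p (λ x → E m p (λ y → 1ℚ - g x y)) ≡ (1ℚ - p * p) ^q m
non-edge-probability zero    p = refl
non-edge-probability (suc m) p = begin
  E (suc m) p (λ x → E (suc m) p (λ y → 1ℚ - g x y))
    ≡⟨ E-suc m p _ ⟩
  E m p (λ x → p * E (suc m) p (λ y → 1ℚ - g (true ∷ x) y) + q * E (suc m) p (λ y → 1ℚ - g (false ∷ x) y))
    ≡⟨ E-cong m p (λ x → cong₂ (λ a b → p * a + q * b) (E-suc m p _) (E-suc m p _)) ⟩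
  E m p (λ x → p * E m p (λ y → p * (1ℚ - 1ℚ) + q * (1ℚ - g x y))
             + q * E m p (λ y → p * (1ℚ - g x y) + q * (1ℚ - g x y)))
    ≡⟨ E-cong m p (λ x → cong₂ (λ a b → p * a + q * b)
         (trans (E-cong m p (λ y → shared-first-attribute p (1ℚ - g x y))) (E-*ˡ m p q _))
         (E-cong m p (λ y → convex p (1ℚ - g x y)))) ⟩
  E m p (λ x → p * (q * N x) + q * N x)
    ≡⟨ E-cong m p (λ x → collect p (N x)) ⟩
  E m p (λ x → (1ℚ - p * p) * N x)
    ≡⟨ E-*ˡ m p (1ℚ - p * p) N ⟩
  (1ℚ - p * p) * E m p N
    ≡⟨ cong ((1ℚ - p * p) *_) (non-edge-probability m p) ⟩
  (1ℚ - p * p) ^q suc m ∎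
  where
  open ≡-Reasoning
  q : ℚ
  q = 1ℚ - p
  N : Att m → ℚ
  N x = E m p (λ y → 1ℚ - g x y)
  shared-first-attribute : ∀ p a → p * (1ℚ - 1ℚ) + (1ℚ - p) * a ≡ (1ℚ - p) * a
  shared-first-attribute = solve-∀ ℚ-ring
  convex : ∀ p a → p * a + (1ℚ - p) * a ≡ a
  convex = solve-∀ ℚ-ring
  collect : ∀ p a → p * ((1ℚ - p) * a) + (1ℚ - p) * a ≡ (1ℚ - p * p) * a
  collect = solve-∀ ℚ-ring

edge-probability : ∀ m p → E m p (λ x → E m p (λ y → g x y)) ≡ phat m p
edge-probability m p = begin
  E m p (λ x → E m p (λ y → g x y))
    ≡⟨ E-cong m p (λ x → E-cong m p (λ y → double-complement (g x y))) ⟩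
  E m p (λ x → E m p (λ y → 1ℚ - (1ℚ - g x y)))
    ≡⟨ E-cong m p (λ x → E-const-sub m p 1ℚ _) ⟩
  E m p (λ x → 1ℚ - E m p (λ y → 1ℚ - g x y))
    ≡⟨ E-const-sub m p 1ℚ _ ⟩
  1ℚ - E m p (λ x → E m p (λ y → 1ℚ - g x y))
    ≡⟨ cong (λ a → 1ℚ - a) (non-edge-probability m p) ⟩
  phat m p ∎
  where
  open ≡-Reasoning
  double-complement : ∀ a → a ≡ 1ℚ - (1ℚ - a)
  double-complement = solve-∀ ℚ-ring

module _ (m : ℕ) (p : ℚ) where

  Ek-cong : ∀ k {f h : Vec (Att m) k → ℚ} → (∀ xs → f xs ≡ h xs) → Ek m p k f ≡ Ek m p k h
  Ek-cong zero    f≡h = f≡h []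
  Ek-cong (suc k) f≡h = E-cong m p (λ x → Ek-cong k (λ xs → f≡h (x ∷ xs)))

  Ek-const : ∀ k c → Ek m p k (λ _ → c) ≡ c
  Ek-const zero    c = refl
  Ek-const (suc k) c = trans (E-cong m p (λ _ → Ek-const k c)) (E-const m p c)

  Ek-+ : ∀ k (f h : Vec (Att m) k → ℚ) → Ek m p k (λ xs → f xs + h xs) ≡ Ek m p k f + Ek m p k h
  Ek-+ zero    f h = refl
  Ek-+ (suc k) f h =
    trans (E-cong m p (λ x → Ek-+ k (λ xs → f (x ∷ xs)) (λ xs → h (x ∷ xs)))) (E-+ m p _ _)

  Ek-*ˡ : ∀ k c (f : Vec (Att m) k → ℚ) → Ek m p k (λ xs → c * f xs) ≡ c * Ek m p k f
  Ek-*ˡ zero    c f = refl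
  Ek-*ˡ (suc k) c f = trans (E-cong m p (λ x → Ek-*ˡ k c (λ xs → f (x ∷ xs)))) (E-*ˡ m p c _)

  Ek-*ʳ : ∀ k c (f : Vec (Att m) k → ℚ) → Ek m p k (λ xs → f xs * c) ≡ Ek m p k f * c
  Ek-*ʳ zero    c f = refl
  Ek-*ʳ (suc k) c f = trans (E-cong m p (λ x → Ek-*ʳ k c (λ xs → f (x ∷ xs)))) (E-*ʳ m p c _)

  Ek-sumL : ∀ {A : Set} k (F : A → Vec (Att m) k → ℚ) as →
    Ek m p k (λ xs → sumL (map (λ a → F a xs) as)) ≡ sumL (map (λ a → Ek m p k (F a)) as)
  Ek-sumL k F []       = Ek-const k 0ℚ
  Ek-sumL k F (a ∷ as) =
    trans (Ek-+ k (F a) (λ xs → sumL (map (λ a → F a xs) as))) (cong (Ek m p k (F a) +_) (Ek-sumL k F as))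

  Ek-*-Ek : ∀ j k (f : Vec (Att m) j → ℚ) (h : Vec (Att m) k → ℚ) →
    Ek m p j f * Ek m p k h ≡ Ek m p j (λ ys → Ek m p k (λ zs → f ys * h zs))
  Ek-*-Ek j k f h = trans (sym (Ek-*ʳ j _ f)) (Ek-cong j (λ ys → sym (Ek-*ˡ k (f ys) h)))

  Ek-insertAt : ∀ k (t : Fin (suc k)) (h : Vec (Att m) (suc k) → ℚ) →
    Ek m p (suc k) h ≡ E m p (λ x → Ek m p k (λ xs → h (insertAt xs t x)))
  Ek-insertAt k       zero    h = refl
  Ek-insertAt (suc k) (suc t) h =
    trans (E-cong m p (λ y → Ek-insertAt k t (λ xs → h (y ∷ xs))))
          (E-swap m p (λ y x → Ek m p k (λ xs → h (y ∷ insertAt xs t x))))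

  Ek-resample : ∀ k (u : Fin k) (h : Vec (Att m) k → ℚ) →
    Ek m p k h ≡ E m p (λ y → Ek m p k (λ xs → h (xs [ u ]≔ y)))
  Ek-resample (suc k) zero    h = sym (E-cong m p (λ y → E-const m p _))
  Ek-resample (suc k) (suc u) h =
    trans (E-cong m p (λ x → Ek-resample k u (λ xs → h (x ∷ xs))))
          (E-swap m p (λ x y → Ek m p k (λ xs → h (x ∷ (xs [ u ]≔ y)))))

-- An injection Fin j → Fin k, read off coordinate by coordinate: each of the k input
-- coordinates is dropped or kept, and a kept one is inserted at the given output position.
data Selection : ℕ → ℕ → Set where
  []   : Selection 0 0
  drop : ∀ {j k} → Selection j k → Selection j (suc k)
  keep : ∀ {j k} → Fin (suc j) → Selection j k → Selection (suc j) (suc k)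

select : ∀ {A : Set} {j k} → Selection j k → Vec A k → Vec A j
select []         []       = []
select (drop σ)   (x ∷ xs) = select σ xs
select (keep t σ) (x ∷ xs) = insertAt (select σ xs) t x

Ek-select : ∀ m p {j k} (σ : Selection j k) (h : Vec (Att m) j → ℚ) →
  Ek m p k (λ xs → h (select σ xs)) ≡ Ek m p j h
Ek-select m p []                h = refl
Ek-select m p (drop σ)          h = trans (E-cong m p (λ _ → Ek-select m p σ h)) (E-const m p _)
Ek-select m p {suc j} (keep t σ) h =
  trans (E-cong m p (λ x → Ek-select m p σ (λ ys → h (insertAt ys t x)))) (sym (Ek-insertAt m p j t h))

edgeIndicator : ∀ {m k} → Vec (Att m) k → Fin k × Fin k → ℚ
edgeIndicator xs e = g (lookup xs (proj₁ e)) (lookup xs (proj₂ e))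

indicator : ∀ {m k} → Graph k → Vec (Att m) k → ℚ
indicator H xs = prodL (map (edgeIndicator xs) H)

indicator-++ : ∀ {m k} (G H : Graph k) (xs : Vec (Att m) k) →
  indicator (G List.++ H) xs ≡ indicator G xs * indicator H xs
indicator-++ []      H xs = sym (ℚ.*-identityˡ _)
indicator-++ (e ∷ G) H xs =
  trans (cong (edgeIndicator xs e *_) (indicator-++ G H xs))
        (sym (ℚ.*-assoc (edgeIndicator xs e) (indicator G xs) (indicator H xs)))

_∉ᵛ_ : ∀ {k} → Fin k → Graph k → Set
u ∉ᵛ H = All (λ e → proj₁ e ≢ u × proj₂ e ≢ u) H

_∉ᵛ?_ : ∀ {k} (u : Fin k) (H : Graph k) → Dec (u ∉ᵛ H)
u ∉ᵛ? H = All.all? (λ e → ¬? (proj₁ e Fin.≟ u) ×-dec ¬? (proj₂ e Fin.≟ u)) H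

indicator-update : ∀ {m k} {u : Fin k} {H : Graph k} → u ∉ᵛ H →
  ∀ (xs : Vec (Att m) k) y → indicator H (xs [ u ]≔ y) ≡ indicator H xs
indicator-update []                   xs y = refl
indicator-update ((a≢u , b≢u) ∷ u∉H) xs y =
  cong₂ _*_ (cong₂ g (lookup∘update′ a≢u xs y) (lookup∘update′ b≢u xs y)) (indicator-update u∉H xs y)

Ek-isolated-edge : ∀ m p k {u v : Fin k} → u ≢ v → (F : Vec (Att m) k → ℚ) →
  (∀ xs y → F (xs [ u ]≔ y) ≡ F xs) → (∀ xs y → F (xs [ v ]≔ y) ≡ F xs) →
  Ek m p k (λ xs → edgeIndicator xs (u , v) * F xs) ≡ phat m p * Ek m p k F
Ek-isolated-edge m p k {u} {v} u≢v F F-u F-v = begin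
  Ek m p k (λ xs → g (lookup xs u) (lookup xs v) * F xs)
    ≡⟨ Ek-resample m p k u _ ⟩
  E m p (λ y → Ek m p k (λ xs → g (lookup (xs [ u ]≔ y) u) (lookup (xs [ u ]≔ y) v) * F (xs [ u ]≔ y)))
    ≡⟨ E-cong m p (λ y → Ek-cong m p k (λ xs →
         cong₂ _*_ (cong₂ g (lookup∘update u xs y) (lookup∘update′ (u≢v ∘ sym) xs y)) (F-u xs y))) ⟩
  E m p (λ y → Ek m p k (λ xs → g y (lookup xs v) * F xs))
    ≡⟨ E-cong m p (λ y → Ek-resample m p k v _) ⟩
  E m p (λ y → E m p (λ z → Ek m p k (λ xs → g y (lookup (xs [ v ]≔ z) v) * F (xs [ v ]≔ z))))
    ≡⟨ E-cong m p (λ y → E-cong m p (λ z → Ek-cong m p k (λ xs →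
         cong₂ _*_ (cong (g y) (lookup∘update v xs z)) (F-v xs z)))) ⟩
  E m p (λ y → E m p (λ z → Ek m p k (λ xs → g y z * F xs)))
    ≡⟨ E-cong m p (λ y → trans (E-cong m p (λ z → Ek-*ˡ m p k (g y z) F)) (E-*ʳ m p _ (g y))) ⟩
  E m p (λ y → E m p (g y) * Ek m p k F)
    ≡⟨ E-*ʳ m p _ (λ y → E m p (g y)) ⟩
  E m p (λ y → E m p (g y)) * Ek m p k F
    ≡⟨ cong (_* Ek m p k F) (edge-probability m p) ⟩
  phat m p * Ek m p k F ∎
  where open ≡-Reasoning

IsolatedEdges : ∀ {k} → Graph k → Graph k → Set
IsolatedEdges G []            = ⊤
IsolatedEdges G ((u , v) ∷ P) = (u ≢ v × u ∉ᵛ (P List.++ G) × v ∉ᵛ (P List.++ G)) × IsolatedEdges G P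

isolatedEdges? : ∀ {k} (G P : Graph k) → Dec (IsolatedEdges G P)
isolatedEdges? G []            = yes tt
isolatedEdges? G ((u , v) ∷ P) =
  (¬? (u Fin.≟ v) ×-dec u ∉ᵛ? (P List.++ G) ×-dec v ∉ᵛ? (P List.++ G)) ×-dec isolatedEdges? G P

Ek-isolated-edges : ∀ m p k (G P : Graph k) → IsolatedEdges G P →
  Ek m p k (indicator (P List.++ G)) ≡ phat m p ^q length P * Ek m p k (indicator G)
Ek-isolated-edges m p k G []            _                            = sym (ℚ.*-identityˡ _)
Ek-isolated-edges m p k G ((u , v) ∷ P) ((u≢v , u∉ , v∉) , isolated) =
  trans (Ek-isolated-edge m p k u≢v (indicator (P List.++ G)) (indicator-update u∉) (indicator-update v∉))
        (trans (cong (phat m p *_) (Ek-isolated-edges m p k G P isolated))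
               (sym (ℚ.*-assoc (phat m p) (phat m p ^q length P) _)))

prefix : ∀ {j n} → j ≤ n → Selection j n
prefix {n = zero}  z≤n      = []
prefix {n = suc n} z≤n      = drop (prefix z≤n)
prefix             (s≤s le) = keep zero (prefix le)

lookup-select-prefix : ∀ {A : Set} {j n} (le : j ≤ n) (xs : Vec A n) (a : Fin j) →
  lookup (select (prefix le) xs) a ≡ lookup xs (inject≤ a le)
lookup-select-prefix (s≤s le) (x ∷ xs) zero    = refl
lookup-select-prefix (s≤s le) (x ∷ xs) (suc a) = lookup-select-prefix le xs a

indicator-embed : ∀ {m n} (le : 8 ≤ n) (H : Graph 8) (xs : Vec (Att m) n) →
  indicator (embed le H) xs ≡ indicator H (select (prefix le) xs)
indicator-embed le []      xs = refl
indicator-embed le (e ∷ H) xs =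
  cong₂ _*_ (sym (cong₂ g (lookup-select-prefix le xs (proj₁ e)) (lookup-select-prefix le xs (proj₂ e))))
            (indicator-embed le H xs)

π-embed : ∀ n m p (le : 8 ≤ n) (H : Graph 8) → π n m p (embed le H) ≡ Ek m p 8 (indicator H)
π-embed n m p le H = trans (Ek-cong m p n (indicator-embed le H)) (Ek-select m p (prefix le) (indicator H))

map-filterᵇ-tabulate : ∀ {A B : Set} {n} (q : A → Bool) (a : A → B) (f : Fin n → A) →
  map a (filterᵇ q (List.tabulate f)) ≡ map (a ∘ f) (filterᵇ (q ∘ f) (allFin n))
map-filterᵇ-tabulate {n = zero}  q a f = refl
map-filterᵇ-tabulate {n = suc n} q a f
  with q (f zero) | map-filterᵇ-tabulate q a (f ∘ suc) | map-filterᵇ-tabulate (q ∘ f) (a ∘ f) suc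
... | true  | tailˡ | tailʳ = cong (a (f zero) ∷_) (trans tailˡ (sym tailʳ))
... | false | tailˡ | tailʳ = trans tailˡ (sym tailʳ)

prodL-sub-expand : ∀ n (a : Fin n → ℚ) c →
  prodL (List.tabulate (λ j → c - a j)) ≡
  sumL (map (λ I → sgn ∣ I ∣ * (c ^q (n ℕ.∸ ∣ I ∣) * prodL (map a (filterᵇ (lookup I) (allFin n)))))
            (allVecs n))
prodL-sub-expand zero    a c = refl
prodL-sub-expand (suc n) a c = begin
  (c - a zero) * prodL (List.tabulate (λ j → c - a (suc j)))
    ≡⟨ cong ((c - a zero) *_) (prodL-sub-expand n (a ∘ suc) c) ⟩
  (c - a zero) * sumL (map (term n (a ∘ suc)) (allVecs n))
    ≡⟨ sym (sumL-*ˡ (c - a zero) (term n (a ∘ suc)) (allVecs n)) ⟩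
  sumL (map (λ I → (c - a zero) * term n (a ∘ suc) I) (allVecs n))
    ≡⟨ sym (sumL-cong split (allVecs n)) ⟩
  sumL (map (λ I → term (suc n) a (true ∷ I) + term (suc n) a (false ∷ I)) (allVecs n))
    ≡⟨ sym (sumL-concatMap-pair (term (suc n) a) (true ∷_) (false ∷_) (allVecs n)) ⟩
  sumL (map (term (suc n) a) (allVecs (suc n))) ∎
  where
  open ≡-Reasoning
  term : ∀ n → (Fin n → ℚ) → Subset n → ℚ
  term n a I = sgn ∣ I ∣ * (c ^q (n ℕ.∸ ∣ I ∣) * prodL (map a (filterᵇ (lookup I) (allFin n))))
  recombine : ∀ c S e a₀ P → (- 1ℚ * S) * (e * (a₀ * P)) + S * ((c * e) * P) ≡ (c - a₀) * (S * (e * P))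
  recombine = solve-∀ ℚ-ring
  split : ∀ I → term (suc n) a (true ∷ I) + term (suc n) a (false ∷ I) ≡ (c - a zero) * term n (a ∘ suc) I
  split I = begin
    sgn (suc s) * (e * (a zero * prodL (map a (filterᵇ (lookup (true ∷ I)) tail))))
      + sgn s * (c ^q (suc n ℕ.∸ s) * prodL (map a (filterᵇ (lookup (false ∷ I)) tail)))
      ≡⟨ cong₂ (λ L R → sgn (suc s) * (e * (a zero * prodL L)) + sgn s * (c ^q (suc n ℕ.∸ s) * prodL R))
               (selected true) (selected false) ⟩
    sgn (suc s) * (e * (a zero * P′)) + sgn s * (c ^q (suc n ℕ.∸ s) * P′)
      ≡⟨ cong (λ k → sgn (suc s) * (e * (a zero * P′)) + sgn s * (c ^q k * P′)) (ℕ.+-∸-assoc 1 (∣p∣≤n I)) ⟩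
    sgn (suc s) * (e * (a zero * P′)) + sgn s * (c * e * P′)
      ≡⟨ recombine c (sgn s) e (a zero) P′ ⟩
    (c - a zero) * term n (a ∘ suc) I ∎
    where
    s : ℕ
    s = ∣ I ∣
    e : ℚ
    e = c ^q (n ℕ.∸ s)
    tail : List (Fin (suc n))
    tail = List.tabulate suc
    P′ : ℚ
    P′ = prodL (map (a ∘ suc) (filterᵇ (lookup I) (allFin n)))
    selected : ∀ b → map a (filterᵇ (lookup (b ∷ I)) tail) ≡ map (a ∘ suc) (filterᵇ (lookup I) (allFin n))
    selected b = map-filterᵇ-tabulate (lookup (b ∷ I)) a suc

arity : Fin 3 → ℕ
arity zero             = 5
arity (suc zero)       = 4
arity (suc (suc zero)) = 5

-- The variables in the order in which LHS integrates them: (v, u₁₁, u₁₂, u₂₁, u₂₂) for i = 0,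
-- (y₁, y₂, x₁, x₂) for i = 1 and (y, x₁, z₁₂, x₂, z₂₂) for i = 2.
contractionEdge : (i : Fin 3) → Fin 4 → Fin (arity i) × Fin (arity i)
contractionEdge zero             ab = (# 0 , suc ab)
contractionEdge (suc zero)       = lookup ((# 2 , # 0) ∷ (# 2 , # 1) ∷ (# 3 , # 0) ∷ (# 3 , # 1) ∷ [])
contractionEdge (suc (suc zero)) = lookup ((# 1 , # 0) ∷ (# 1 , # 2) ∷ (# 3 , # 0) ∷ (# 3 , # 4) ∷ [])

relabelling : (i : Fin 3) → Selection (arity i) 8
relabelling zero             = prefix (s≤s (s≤s (s≤s (s≤s (s≤s z≤n)))))
relabelling (suc zero)       = keep (# 2) (keep (# 2) (keep zero (keep zero (prefix z≤n))))
relabelling (suc (suc zero)) = keep (# 1) (keep (# 2) (keep zero (keep zero (keep zero (prefix z≤n)))))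

module _ (m : ℕ) (p : ℚ) where

  ḡ-edge : ∀ {k} → (Fin 4 → Fin k × Fin k) → Vec (Att m) k → Fin 4 → ℚ
  ḡ-edge e xs ab = edgeIndicator xs (e ab) - phat m p

  centredProduct : ∀ {k} → (Fin 4 → Fin k × Fin k) → Vec (Att m) k → ℚ
  centredProduct e xs = prodL (map (ḡ-edge e xs) labels)

  private
    c : ℚ
    c = phat m p
    ḡ : Att m → Att m → ℚ
    ḡ x y = g x y - c
    g₁-centred : ∀ x → g₁ m p x - c ≡ E m p (ḡ x)
    g₁-centred x = sym (E-sub-const m p (g x) c)

  groupedProduct : ∀ {k} → (Fin 4 → Fin k × Fin k) → Vec (Att m) k → ℚ
  groupedProduct e xs = f (# 0) * f (# 1) * (f (# 2) * f (# 3))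
    where
    f : Fin 4 → ℚ
    f = ḡ-edge e xs

  groupedProduct≡centredProduct : ∀ {k} (e : Fin 4 → Fin k × Fin k) (xs : Vec (Att m) k) →
    groupedProduct e xs ≡ centredProduct e xs
  groupedProduct≡centredProduct e xs = regroup (f (# 0)) (f (# 1)) (f (# 2)) (f (# 3))
    where
    regroup : ∀ a b d e → a * b * (d * e) ≡ a * (b * (d * (e * 1ℚ)))
    regroup = solve-∀ ℚ-ring
    f : Fin 4 → ℚ
    f = ḡ-edge e xs

  centredProduct-relabel : ∀ i (xs : Vec (Att m) 8) →
    centredProduct (contractionEdge i) (select (relabelling i) xs) ≡ centredProduct (edgeG i) xs
  centredProduct-relabel zero             (_ ∷ _ ∷ _ ∷ _ ∷ _ ∷ _ ∷ _ ∷ _ ∷ []) = refl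
  centredProduct-relabel (suc zero)       (_ ∷ _ ∷ _ ∷ _ ∷ _ ∷ _ ∷ _ ∷ _ ∷ []) = refl
  centredProduct-relabel (suc (suc zero)) (_ ∷ _ ∷ _ ∷ _ ∷ _ ∷ _ ∷ _ ∷ _ ∷ []) = refl

  LHS-integral : ∀ i → LHS m p i ≡ Ek m p (arity i) (centredProduct (contractionEdge i))
  LHS-integral zero = begin
    E m p (λ v → (g₁ m p v - c) * (g₁ m p v - c) * ((g₁ m p v - c) * (g₁ m p v - c)))
      ≡⟨ E-cong m p (λ v → cong (λ a → a * a * (a * a)) (g₁-centred v)) ⟩
    E m p (λ v → E m p (ḡ v) * E m p (ḡ v) * (E m p (ḡ v) * E m p (ḡ v)))
      ≡⟨ E-cong m p (λ v → fourfold (ḡ v)) ⟩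
    Ek m p 5 (groupedProduct (contractionEdge zero))
      ≡⟨ Ek-cong m p 5 (groupedProduct≡centredProduct (contractionEdge zero)) ⟩
    Ek m p 5 (centredProduct (contractionEdge zero)) ∎
    where
    open ≡-Reasoning
    pair : (Att m → ℚ) → Vec (Att m) 2 → ℚ
    pair f ys = f (lookup ys (# 0)) * f (lookup ys (# 1))
    fourfold : (f : Att m → ℚ) →
      E m p f * E m p f * (E m p f * E m p f) ≡ Ek m p 2 (λ ys → Ek m p 2 (λ zs → pair f ys * pair f zs))
    fourfold f = trans (cong₂ _*_ E-*-E E-*-E) (Ek-*-Ek m p 2 2 (pair f) (pair f))
      where
      E-*-E : E m p f * E m p f ≡ Ek m p 1 (λ ys → Ek m p 1 (λ zs → f (head ys) * f (head zs)))
      E-*-E = Ek-*-Ek m p 1 1 (f ∘ head) (f ∘ head)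
  LHS-integral (suc zero) = begin
    E m p (λ y → E m p (λ z → E m p (λ w → ḡ w y * ḡ w z) * E m p (λ w → ḡ w y * ḡ w z)))
      ≡⟨ E-cong m p (λ y → E-cong m p (λ z → Ek-*-Ek m p 1 1 (star y z) (star y z))) ⟩
    Ek m p 4 (groupedProduct (contractionEdge (suc zero)))
      ≡⟨ Ek-cong m p 4 (groupedProduct≡centredProduct (contractionEdge (suc zero))) ⟩
    Ek m p 4 (centredProduct (contractionEdge (suc zero))) ∎
    where
    open ≡-Reasoning
    star : Att m → Att m → Vec (Att m) 1 → ℚ
    star y z ws = ḡ (head ws) y * ḡ (head ws) z
  LHS-integral (suc (suc zero)) = begin
    E m p (λ y → E m p (λ w → ḡ w y * (g₁ m p w - c)) * E m p (λ w → ḡ w y * (g₁ m p w - c)))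
      ≡⟨ E-cong m p (λ y → cong (λ a → a * a) (E-cong m p (λ w →
           trans (cong (ḡ w y *_) (g₁-centred w)) (sym (E-*ˡ m p (ḡ w y) (ḡ w)))))) ⟩
    E m p (λ y → E m p (λ w → E m p (λ z → ḡ w y * ḡ w z)) * E m p (λ w → E m p (λ z → ḡ w y * ḡ w z)))
      ≡⟨ E-cong m p (λ y → Ek-*-Ek m p 2 2 (path y) (path y)) ⟩
    Ek m p 5 (groupedProduct (contractionEdge (suc (suc zero))))
      ≡⟨ Ek-cong m p 5 (groupedProduct≡centredProduct (contractionEdge (suc (suc zero)))) ⟩
    Ek m p 5 (centredProduct (contractionEdge (suc (suc zero)))) ∎
    where
    open ≡-Reasoning
    path : Att m → Vec (Att m) 2 → ℚ
    path y ws = ḡ (lookup ws (# 0)) y * ḡ (lookup ws (# 0)) (lookup ws (# 1))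

∈-allVecs : ∀ {m} (x : Vec Bool m) → x ∈ allVecs m
∈-allVecs []      = here refl
∈-allVecs (b ∷ x) =
  ∈-concatMap⁺ (λ z → (true ∷ z) ∷ (false ∷ z) ∷ []) (Any.map (λ { refl → b∷x∈ b }) (∈-allVecs x))
  where
  b∷x∈ : ∀ b → (b ∷ x) ∈ (true ∷ x) ∷ (false ∷ x) ∷ []
  b∷x∈ true  = here refl
  b∷x∈ false = there (here refl)

isolatedPart : Fin 3 → Subset 4 → Graph 8
isolatedPart i I = pairUp (filterᵇ (λ ab → not (ab ∈I I)) labels)
                          (filterᵇ (λ v → not (usedBy (edgesGI i I) v)) allFin8)

IsolatedPartSpec : Fin 3 → Subset 4 → Set
IsolatedPartSpec i I =
  length (isolatedPart i I) ≡ 4 ℕ.∸ ∣ I ∣ × IsolatedEdges (edgesGI i I) (isolatedPart i I)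

isolatedPart-spec : ∀ i I → IsolatedPartSpec i I
isolatedPart-spec i I = All.lookup (All.lookup allChecked (∈-allFin i)) (∈-allVecs I)
  where
  allChecked : All (λ i → All (IsolatedPartSpec i) allSubsets) (allFin 3)
  allChecked = from-yes (All.all? (λ i → All.all? (spec? i) allSubsets) (allFin 3))
    where
    spec? : ∀ i I → Dec (IsolatedPartSpec i I)
    spec? i I = length (isolatedPart i I) ℕ.≟ 4 ℕ.∸ ∣ I ∣ ×-dec isolatedEdges? (edgesGI i I) (isolatedPart i I)

π-H : ∀ n m p (le : 8 ≤ n) i I →
  π n m p (H le i I) ≡ phat m p ^q (4 ℕ.∸ ∣ I ∣) * Ek m p 8 (indicator (edgesGI i I))
π-H n m p le i I = begin
  π n m p (embed le (G List.++ P))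
    ≡⟨ π-embed n m p le (G List.++ P) ⟩
  Ek m p 8 (indicator (G List.++ P))
    ≡⟨ Ek-cong m p 8 (λ xs → trans (indicator-++ G P xs)
                              (trans (*-comm (indicator G xs) (indicator P xs)) (sym (indicator-++ P G xs)))) ⟩
  Ek m p 8 (indicator (P List.++ G))
    ≡⟨ Ek-isolated-edges m p 8 G P isolated ⟩
  phat m p ^q length P * Ek m p 8 (indicator G)
    ≡⟨ cong (λ k → phat m p ^q k * Ek m p 8 (indicator G)) length≡ ⟩
  phat m p ^q (4 ℕ.∸ ∣ I ∣) * Ek m p 8 (indicator G) ∎
  where
  open ≡-Reasoning
  G P : Graph 8
  G = edgesGI i I
  P = isolatedPart i I
  length≡ : length P ≡ 4 ℕ.∸ ∣ I ∣
  length≡ = proj₁ (isolatedPart-spec i I)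
  isolated : IsolatedEdges G P
  isolated = proj₂ (isolatedPart-spec i I)

centredProduct-expand : ∀ m p i (xs : Vec (Att m) 8) →
  centredProduct m p (edgeG i) xs ≡
  sumL (map (λ I → sgn ∣ I ∣ * (phat m p ^q (4 ℕ.∸ ∣ I ∣) * indicator (edgesGI i I) xs)) allSubsets)
centredProduct-expand m p i xs = begin
  centredProduct m p (edgeG i) xs
    ≡⟨ even-flip (a (# 0)) (a (# 1)) (a (# 2)) (a (# 3)) c ⟩
  prodL (List.tabulate (λ ab → c - a ab))
    ≡⟨ prodL-sub-expand 4 a c ⟩
  sumL (map (λ I → sgn ∣ I ∣ * (c ^q (4 ℕ.∸ ∣ I ∣) * prodL (map a (filterᵇ (lookup I) labels)))) allSubsets)
    ≡⟨ sumL-cong (λ I → cong (λ es → sgn ∣ I ∣ * (c ^q (4 ℕ.∸ ∣ I ∣) * prodL es))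
                             (map-∘ {g = edgeIndicator xs} {f = edgeG i} (filterᵇ (lookup I) labels)))
                 allSubsets ⟩
  sumL (map (λ I → sgn ∣ I ∣ * (c ^q (4 ℕ.∸ ∣ I ∣) * indicator (edgesGI i I) xs)) allSubsets) ∎
  where
  open ≡-Reasoning
  c : ℚ
  c = phat m p
  a : Fin 4 → ℚ
  a ab = edgeIndicator xs (edgeG i ab)
  even-flip : ∀ a₀ a₁ a₂ a₃ c → (a₀ - c) * ((a₁ - c) * ((a₂ - c) * ((a₃ - c) * 1ℚ)))
                               ≡ (c - a₀) * ((c - a₁) * ((c - a₂) * ((c - a₃) * 1ℚ)))
  even-flip = solve-∀ ℚ-ring

-- Both sides are polynomials in p.
lemma6p2 : (n m : ℕ) → (le : 8 ≤ n) → (p : ℚ) → 0ℚ < p → p < 1ℚ →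
    (i : Fin 3) → LHS m p i ≡ RHS n m p le i
lemma6p2 n m le p _ _ i = begin
  LHS m p i
    ≡⟨ LHS-integral m p i ⟩
  Ek m p (arity i) (centredProduct m p (contractionEdge i))
    ≡⟨ sym (Ek-select m p (relabelling i) (centredProduct m p (contractionEdge i))) ⟩
  Ek m p 8 (λ xs → centredProduct m p (contractionEdge i) (select (relabelling i) xs))
    ≡⟨ Ek-cong m p 8 (centredProduct-relabel m p i) ⟩
  Ek m p 8 (centredProduct m p (edgeG i))
    ≡⟨ Ek-cong m p 8 (centredProduct-expand m p i) ⟩
  Ek m p 8 (λ xs → sumL (map (λ I → term I xs) allSubsets))
    ≡⟨ Ek-sumL m p 8 term allSubsets ⟩
  sumL (map (λ I → Ek m p 8 (term I)) allSubsets)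
    ≡⟨ sumL-cong Ek-term allSubsets ⟩
  RHS n m p le i ∎
  where
  open ≡-Reasoning
  term : Subset 4 → Vec (Att m) 8 → ℚ
  term I xs = sgn ∣ I ∣ * (phat m p ^q (4 ℕ.∸ ∣ I ∣) * indicator (edgesGI i I) xs)
  Ek-term : ∀ I → Ek m p 8 (term I) ≡ sgn ∣ I ∣ * π n m p (H le i I)
  Ek-term I = trans (Ek-*ˡ m p 8 (sgn ∣ I ∣) (λ xs → pow * indicator (edgesGI i I) xs))
                    (cong (sgn ∣ I ∣ *_) (trans (Ek-*ˡ m p 8 pow (indicator (edgesGI i I)))
                                                (sym (π-H n m p le i I))))
    where
    pow : ℚ
    pow = phat m p ^q (4 ℕ.∸ ∣ I ∣)
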